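{- There exist a finite set $S$ of elements given in a stream order, a weight function $w:S\to\mathbb R_{\ge0}$, and three matroids $M_1=(S,\mathcal I_1)$, $M_2=(S,\mathcal I_2)$, $M_3=(S,\mathcal I_3)$ such that, for every $\alpha>1$ sufficiently close to $1$ and every sufficiently large $y$, Algorithm K (described in the context) with $k=3$ run on this stream keeps all of $S$, and for the resulting orders $<_1,<_2,<_3$ there is no $T\subseteq S$ that is independent in $M_1$, $M_2$ and $M_3$ and satisfies $S=D_{M_1}(T)\cup D_{M_2}(T)\cup D_{M_3}(T)$.
   Context: For a matroid $M$, $\mathrm{span}_M(X)=\{e:\mathrm{rank}_M(X\cup\{e\})=\mathrm{rank}_M(X)\}$. Algorithm K for matroids $M_1,\dots,M_k$ on a common ground set, weights $w$, parameters $\alpha>1$ and real $y$: initialize $S=\emptyset$; elements arrive in stream order. When $e$ arrives, for each $i$ compute $w_i^*(e)=\max\bigl(\{0\}\cup\{\theta:e\in\mathrm{span}_{M_i}(\{f\in S:w_i(f)\ge\theta\})\}\bigr)$. If $w(e)>\alpha\sum_{i=1}^k w_i^*(e)$, set $g(e)=w(e)-\sum_i w_i^*(e)$, add $e$ to $S$, set $w_i(e)=g(e)+w_i^*(e)$ for each $i$, let $T_i$ be a maximum $w_i$-weight independent set of $M_i$ among elements of $S$, let $g_{\max}=\max_{e'\in S}g(e')$, and remove from $S$ all $e'$ with $y\cdot g(e')<g_{\max}$ and $e'\notin\bigcup_i T_i$; otherwise discard $e$. The order $<_i$ on $S$: $e<_i f$ iff $w_i(e)>w_i(f)$, or $w_i(e)=w_i(f)$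 and $e$ appeared later in the stream than $f$. For $T\subseteq S$, $D_{M_i}(T)$ is the set of elements $e\in S$ such that $e\in T$ or there is $C_e\subseteq T$ with $e\in\mathrm{span}_{M_i}(C_e)$ and $c<_i e$ for all $c\in C_e$.
   Formalization: The parameters α and y range only over the rationals, and the weight function w and the thresholds θ defining $w_i^*(e)$ are taken in ℚ. -}

module Defs where

open import Data.Nat using (ℕ; suc)
import Data.Nat as ℕ
open import Data.Bool using (Bool; true; false; _∧_; if_then_else_)
open import Data.Fin using (Fin)
import Data.Fin as F
open import Data.Fin.Subset using (Subset; _∈_; _∉_; _⊆_; _∪_; ⁅_⁆; ∣_∣; ⊥)
open import Data.Vec using (lookup; tabulate; _[_]≔_)
open import Data.List using (List; []; _∷_; foldr; map; allFin)
open import Data.Rational using (ℚ; 0ℚ; _+_; _-_; _*_; _≤_; _<_)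
open import Data.Rational.Properties using (_≤?_)
open import Data.Product using (Σ; ∃; _×_; _,_)
open import Data.Sum using (_⊎_)
open import Relation.Nullary using (¬_; does)
open import Relation.Binary.PropositionalEquality using (_≡_)
open import Level using (Level; 0ℓ; suc)

record Matroid (n : ℕ) : Set₁ where
  field
    Indep    : Subset n → Set
    indep-⊥  : Indep ⊥
    hered    : ∀ {A B} → A ⊆ B → Indep B → Indep A
    exchange : ∀ {A B} → Indep A → Indep B → ∣ A ∣ ℕ.< ∣ B ∣ →
               ∃ λ x → x ∈ B × x ∉ A × Indep (A ∪ ⁅ x ⁆)
open Matroid public

module _ {n : ℕ} (M : Matroid n) where

  IsRank : Subset n → ℕ → Set
  IsRank X r = (∃ λ I → I ⊆ X × Indep M I × ∣ I ∣ ≡ r)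
             × (∀ I → I ⊆ X → Indep M I → ∣ I ∣ ℕ.≤ r)

  InSpan : Fin n → Subset n → Set
  InSpan e X = ∃ λ r → IsRank X r × IsRank (X ∪ ⁅ e ⁆) r

sumℚ : ∀ {A : Set} → List A → (A → ℚ) → ℚ
sumℚ xs f = foldr (λ a s → f a + s) 0ℚ xs

Σℚ : (k : ℕ) → (Fin k → ℚ) → ℚ
Σℚ k f = sumℚ (allFin k) f

weight : ∀ {n} → (Fin n → ℚ) → Subset n → ℚ
weight {n} v T = sumℚ (allFin n) (λ f → if lookup T f then v f else 0ℚ)

record State (k n : ℕ) : Set where
  constructor st
  field
    S  : Subset n
    g  : Fin n → ℚ             -- g(e)  (meaningful for e ∈ S)
    ws : Fin k → Fin n → ℚ     -- w_i(e) (meaningful for e ∈ S)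
open State public

initState : ∀ {k n} → State k n
initState = st ⊥ (λ _ → 0ℚ) (λ _ _ → 0ℚ)

module AlgorithmK {k n : ℕ} (M : Fin k → Matroid n) (w : Fin n → ℚ)
                  (α y : ℚ) where

  above : Subset n → (Fin n → ℚ) → ℚ → Subset n
  above S v θ = tabulate (λ f → lookup S f ∧ does (θ ≤? v f))

  IsWStar : Fin k → Subset n → (Fin n → ℚ) → Fin n → ℚ → Set
  IsWStar i S v e x =
      (x ≡ 0ℚ ⊎ InSpan (M i) e (above S v x))
    × 0ℚ ≤ x
    × (∀ θ → InSpan (M i) e (above S v θ) → θ ≤ x)

  IsMaxWeightIndep : Fin k → Subset n → (Fin n → ℚ) → Subset n → Set
  IsMaxWeightIndep i S v T =
      T ⊆ S × Indep (M i) T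
    × (∀ T' → T' ⊆ S → Indep (M i) T' → weight v T' ≤ weight v T)

  IsMaxOn : Subset n → (Fin n → ℚ) → ℚ → Set
  IsMaxOn S g m = (∃ λ f → f ∈ S × g f ≡ m) × (∀ f → f ∈ S → g f ≤ m)

  _[_]≔'_ : (Fin n → ℚ) → Fin n → ℚ → (Fin n → ℚ)
  (v [ e ]≔' q) f = if does (f F.≟ e) then q else v f

  data Step : State k n → Fin n → State k n → Set where
    accept : ∀ {s e} (x : Fin k → ℚ) (T : Fin k → Subset n) (gmax : ℚ)
               (S' : Subset n) →
      (∀ i → IsWStar i (S s) (ws s i) e (x i)) →
      α * Σℚ k x < w e →
      let g' = g s [ e ]≔' (w e - Σℚ k x) in
      let ws' = λ i → ws s i [ e ]≔' ((w e - Σℚ k x) + x i) in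
      let S₁ = S s ∪ ⁅ e ⁆ in
      (∀ i → IsMaxWeightIndep i S₁ (ws' i) (T i)) →
      IsMaxOn S₁ g' gmax →
      (∀ f → (f ∈ S' → f ∈ S₁ × (gmax ≤ y * g' f ⊎ ∃ λ i → f ∈ T i))
           × (f ∈ S₁ × (gmax ≤ y * g' f ⊎ ∃ λ i → f ∈ T i) → f ∈ S')) →
      Step s e (st S' g' ws')
    reject : ∀ {s e} (x : Fin k → ℚ) →
      (∀ i → IsWStar i (S s) (ws s i) e (x i)) →
      ¬ (α * Σℚ k x < w e) →
      Step s e s

  data Run : State k n → List (Fin n) → State k n → Set where
    done : ∀ {s} → Run s [] s
    next : ∀ {s s' s'' e es} → Step s e s' → Run s' es s'' → Run s (e ∷ es) s''

  FinalState : State k n → Set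
  FinalState s = Run initState (allFin n) s

module _ {n : ℕ} where

  _≺[_]_ : Fin n → (Fin n → ℚ) → Fin n → Set
  e ≺[ v ] f = v f < v e ⊎ (v e ≡ v f × f F.< e)

  InD : Matroid n → (Fin n → ℚ) → Subset n → Subset n → Fin n → Set
  InD M v S T e = e ∈ S ×
    (e ∈ T ⊎ ∃ λ C → C ⊆ T × InSpan M e C × (∀ c → c ∈ C → c ≺[ v ] e))

-- Ground set a, b, c, d (= 0, 1, 2, 3) with weights 4, 6, 3, 4, and the three matroids whose
-- only circuits are {b, c}, {a, c, d} and {a, b}.  On this stream Algorithm K accepts every
-- element, with w*-values (0,0,0), (0,0,4), (2,0,0), (0,1,0); the acceptance inequalities
-- hold for α < 5/4, and the gains 4, 2, 1, 3 all lie in [1, 4], so for y ≥ 4 nothing is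
-- ever removed.  Since w* is uniquely determined, every run of the algorithm agrees with this
-- trace on the stored set and on the weights w_i.  Finally no set T independent in all three
-- matroids has D_{M_1}(T) ∪ D_{M_2}(T) ∪ D_{M_3}(T) = S: the only candidates have at most two
-- elements, and an exhaustive check finds an uncovered element for each.  All finite facts
-- (matroid axioms, spans, maximum-weight sets, the covering) are decided by enumerating the
-- subsets of the four-element ground set.
module Submission where

open import Defs
open import Data.Bool using (Bool; true; false; T; _∧_)
open import Data.Bool.Properties using (T-≡; T-∧)
open import Data.Empty using (⊥-elim)
open import Data.Fin using (Fin)
import Data.Fin as F
open import Data.Fin.Properties using (any?; all?)
open import Data.Fin.Subset using (Subset; _∈_; _∉_; _⊆_; _∪_; ⁅_⁆; ∣_∣; ⊥; inside; outside)
open import Data.Fin.Subset.Properties using (_∈?_; _⊆?_; anySubset?; ⊆-antisym; ∣p∣≤n)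
open import Data.Integer using (+_)
open import Data.List using (List; []; _∷_; allFin)
open import Data.Nat using (ℕ; suc; s≤s) renaming (_<_ to _<ℕ_; _≤_ to _≤ℕ_)
import Data.Nat.Properties as ℕ
open import Data.Product using (Σ; ∃; _×_; _,_; proj₁; proj₂)
import Data.Product as Product
open import Data.Rational using (ℚ; 0ℚ; 1ℚ; _/_; _+_; _-_; _*_; _≤_; _<_; nonNegative)
open import Data.Rational.Properties
  using (_≤?_; _<?_; ≤-refl; ≤-trans; ≤-antisym; <-≤-trans; ≤-<-trans; <⇒≤; ≰⇒>;
         +-mono-≤; *-monoʳ-≤-nonNeg; *-monoˡ-≤-nonNeg; *-identityʳ; nonNegative⁻¹)
import Data.Rational.Properties as ℚ
open import Data.Sum using (_⊎_; inj₁; inj₂)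
import Data.Sum as Sum
open import Data.Vec using ([]; _∷_; lookup; tabulate)
open import Data.Vec.Properties using (lookup∘tabulate; tabulate-cong; []=⇒lookup; lookup⇒[]=)
open import Function using (_∘_; _⇔_; Equivalence; mk⇔)
open import Level using (0ℓ)
open import Relation.Binary.PropositionalEquality
open import Relation.Nullary using (¬_; Dec; yes; no; does; ¬?; _×-dec_; _⊎-dec_; _→-dec_)
open import Relation.Nullary.Decidable using (True; map′; decidable-stable; dec-true; toWitness; from-yes; from-no)
open import Relation.Unary using (Pred; Decidable)

open Equivalence

allSubset? : ∀ {n ℓ} {P : Pred (Subset n) ℓ} → Decidable P → Dec (∀ p → P p)
allSubset? P? = map′ (λ ¬∃¬P p → decidable-stable (P? p) (λ ¬Pp → ¬∃¬P (p , ¬Pp)))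
                     (λ ∀P (p , ¬Pp) → ¬Pp (∀P p))
                     (¬? (anySubset? (¬? ∘ P?)))

T-does⁻ : ∀ {P : Set} (P? : Dec P) → T (does P?) → P
T-does⁻ (yes p) _ = p

T-does⁺ : ∀ {P : Set} (P? : Dec P) → P → T (does P?)
T-does⁺ P? p = from T-≡ (dec-true P? p)

∈⇔T-lookup : ∀ {n} {f : Fin n} {X : Subset n} → f ∈ X ⇔ T (lookup X f)
∈⇔T-lookup {f = f} {X} = mk⇔ (from T-≡ ∘ []=⇒lookup) (lookup⇒[]= f X ∘ to T-≡)

∈-tabulate : ∀ {n} {b : Fin n → Bool} {f} → f ∈ tabulate b ⇔ T (b f)
∈-tabulate {b = b} {f} = mk⇔ (subst T (lookup∘tabulate b f) ∘ to ∈⇔T-lookup)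
                             (from ∈⇔T-lookup ∘ subst T (sym (lookup∘tabulate b f)))

sumℚ-cong : ∀ {A : Set} (xs : List A) {f f' : A → ℚ} → f ≗ f' → sumℚ xs f ≡ sumℚ xs f'
sumℚ-cong []       _    = refl
sumℚ-cong (a ∷ xs) f≗f' = cong₂ _+_ (f≗f' a) (sumℚ-cong xs f≗f')

sumℚ-nonNeg : ∀ {A : Set} (xs : List A) {f : A → ℚ} → (∀ a → 0ℚ ≤ f a) → 0ℚ ≤ sumℚ xs f
sumℚ-nonNeg []       _   = ≤-refl
sumℚ-nonNeg (a ∷ xs) 0≤f = +-mono-≤ (0≤f a) (sumℚ-nonNeg xs 0≤f)

p≤q∧q*r<s⇒p*r<s : ∀ {p q r s} → p ≤ q → 0ℚ ≤ r → q * r < s → p * r < s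
p≤q∧q*r<s⇒p*r<s {r = r} p≤q 0≤r = ≤-<-trans (*-monoʳ-≤-nonNeg r {{nonNegative 0≤r}} p≤q)

1≤a∧1≤b≤y⇒b≤y*a : ∀ {a b y} → 1ℚ ≤ a → 1ℚ ≤ b → b ≤ y → b ≤ y * a
1≤a∧1≤b≤y⇒b≤y*a {a} {b} {y} 1≤a 1≤b b≤y =
  ≤-trans b≤y (subst (_≤ y * a) (*-identityʳ y) (*-monoˡ-≤-nonNeg y {{nonNegative 0≤y}} 1≤a))
  where 0≤y = ≤-trans (nonNegative⁻¹ 1ℚ) (≤-trans 1≤b b≤y)

module IndependenceAxioms {n : ℕ} {Ind : Pred (Subset n) 0ℓ} (Ind? : Decidable Ind) where

  Hereditary : Set
  Hereditary = ∀ A B → A ⊆ B → Ind B → Ind A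

  Augmentable : Set
  Augmentable = ∀ A B → Ind A → Ind B → ∣ A ∣ <ℕ ∣ B ∣ →
                ∃ λ x → x ∈ B × x ∉ A × Ind (A ∪ ⁅ x ⁆)

  hereditary? : Dec Hereditary
  hereditary? = allSubset? λ A → allSubset? λ B →
    A ⊆? B →-dec Ind? B →-dec Ind? A

  augmentable? : Dec Augmentable
  augmentable? = allSubset? λ A → allSubset? λ B →
    Ind? A →-dec Ind? B →-dec ∣ A ∣ ℕ.<? ∣ B ∣ →-dec
    any? λ x → x ∈? B ×-dec ¬? (x ∈? A) ×-dec Ind? (A ∪ ⁅ x ⁆)

  matroid : Ind ⊥ → Hereditary → Augmentable → Matroid n
  matroid ind-⊥ hered aug = record
    { Indep    = Ind
    ; indep-⊥  = ind-⊥
    ; hered    = λ {A} {B} → hered A B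
    ; exchange = λ {A} {B} → aug A B
    }

module SingleCircuit {n : ℕ} (C : Subset n) where

  Avoids : Pred (Subset n) 0ℓ
  Avoids A = ¬ C ⊆ A

  avoids? : Decidable Avoids
  avoids? A = ¬? (C ⊆? A)

  open IndependenceAxioms avoids?

  Axioms : Set
  Axioms = Avoids ⊥ × Hereditary × Augmentable

  axioms? : Dec Axioms
  axioms? = avoids? ⊥ ×-dec hereditary? ×-dec augmentable?

  singleCircuitMatroid : Axioms → Matroid n
  singleCircuitMatroid (ind-⊥ , hered , aug) = matroid ind-⊥ hered aug

module DecidableMatroid {n : ℕ} (M : Matroid n) (Indep? : Decidable (Indep M)) where

  isRank? : ∀ X r → Dec (IsRank M X r)
  isRank? X r =
    anySubset? (λ I → I ⊆? X ×-dec Indep? I ×-dec ∣ I ∣ ℕ.≟ r)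
    ×-dec allSubset? (λ I → I ⊆? X →-dec Indep? I →-dec ∣ I ∣ ℕ.≤? r)

  isRank⇒≤ : ∀ {X r} → IsRank M X r → r ≤ℕ n
  isRank⇒≤ ((I , _ , _ , refl) , _) = ∣p∣≤n I

  inSpan? : ∀ e X → Dec (InSpan M e X)
  inSpan? e X = map′ (λ (r , _ , ranks) → r , ranks)
                     (λ (r , ranks@(rankX , _)) → r , s≤s (isRank⇒≤ rankX) , ranks)
                     (ℕ.anyUpTo? (λ r → isRank? X r ×-dec isRank? (X ∪ ⁅ e ⁆) r) (suc n))

module _ {n : ℕ} where

  ≺-cong : ∀ {v v' : Fin n → ℚ} {e f} → v ≗ v' → e ≺[ v ] f → e ≺[ v' ] f
  ≺-cong v≗v' (inj₁ vf<ve)         = inj₁ (subst₂ _<_ (v≗v' _) (v≗v' _) vf<ve)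
  ≺-cong v≗v' (inj₂ (ve≡vf , f<e)) = inj₂ (trans (sym (v≗v' _)) (trans ve≡vf (v≗v' _)) , f<e)

  ≺? : (v : Fin n → ℚ) → ∀ e f → Dec (e ≺[ v ] f)
  ≺? v e f = v f <? v e ⊎-dec (v e ℚ.≟ v f ×-dec f F.<? e)

  InD-cong : ∀ {M} {v v' : Fin n → ℚ} {X T e} → v ≗ v' → InD M v X T e → InD M v' X T e
  InD-cong v≗v' (e∈X , inj₁ e∈T)                   = e∈X , inj₁ e∈T
  InD-cong v≗v' (e∈X , inj₂ (C , C⊆T , span , ≺e)) =
    e∈X , inj₂ (C , C⊆T , span , λ c c∈C → ≺-cong v≗v' (≺e c c∈C))

  strictlyAbove : Subset n → (Fin n → ℚ) → ℚ → Subset n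
  strictlyAbove X v θ = tabulate (λ f → lookup X f ∧ does (θ <? v f))

module _ {k n : ℕ} where

  record _≈ˢ_ (s t : State k n) : Set where
    field
      sameS  : S s ≡ S t
      sameG  : g s ≗ g t
      sameWs : ∀ i → ws s i ≗ ws t i
  open _≈ˢ_ public

  ≈ˢ-refl : ∀ {s} → s ≈ˢ s
  ≈ˢ-refl = record { sameS = refl ; sameG = λ _ → refl ; sameWs = λ _ _ → refl }

  IndependentCover : (Fin k → Matroid n) → State k n → Subset n → Set
  IndependentCover M s T = T ⊆ S s × (∀ i → Indep (M i) T)
                         × (∀ e → e ∈ S s → ∃ λ i → InD (M i) (ws s i) (S s) T e)

  independentCover-cong : ∀ {M s t T} → s ≈ˢ t → IndependentCover M s T → IndependentCover M t T
  independentCover-cong {M} {s} {t} {T} s≈t (T⊆S , indep , covered) =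
    subst (T ⊆_) (sameS s≈t) T⊆S , indep , λ e e∈S →
      let i , d = covered e (subst (e ∈_) (sym (sameS s≈t)) e∈S)
      in  i , subst (λ X → InD (M i) (ws t i) X T e) (sameS s≈t) (InD-cong {M = M i} (sameWs s≈t i) d)

module Steps {k n : ℕ} (M : Fin k → Matroid n) (w : Fin n → ℚ) (α y : ℚ) where
  open AlgorithmK M w α y public

  ≔'-cong : ∀ {v v' : Fin n → ℚ} {q q'} e → v ≗ v' → q ≡ q' → (v [ e ]≔' q) ≗ (v' [ e ]≔' q')
  ≔'-cong e v≗v' refl f with does (f F.≟ e)
  ... | true  = refl
  ... | false = v≗v' f

  above-cong : ∀ {X} {v v' : Fin n → ℚ} θ → v ≗ v' → above X v θ ≡ above X v' θ
  above-cong {X} θ v≗v' = tabulate-cong λ f → cong (λ q → lookup X f ∧ does (θ ≤? q)) (v≗v' f)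

  above-⊆-strictlyAbove : ∀ {X v x θ} → x < θ → above X v θ ⊆ strictlyAbove X v x
  above-⊆-strictlyAbove {X} {v} {x} {θ} x<θ {f} f∈ =
    let f∈X , θ≤vf = to (T-∧ {lookup X f}) (to ∈-tabulate f∈)
    in  from ∈-tabulate (from (T-∧ {lookup X f})
          (f∈X , T-does⁺ (x <? v f) (<-≤-trans x<θ (T-does⁻ (θ ≤? v f) θ≤vf))))

  isWStar-cong : ∀ {i X} {v v' : Fin n → ℚ} {e x} → v ≗ v' → IsWStar i X v e x → IsWStar i X v' e x
  isWStar-cong {i} {X} {v} {v'} {e} {x} v≗v' (attained , 0≤x , maximal) =
    Sum.map₂ (subst (InSpan (M i) e) (above-cong {X} {v} {v'} x v≗v')) attained , 0≤x ,
    λ θ → maximal θ ∘ subst (InSpan (M i) e) (sym (above-cong {X} {v} {v'} θ v≗v'))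

  isWStar-≤ : ∀ {i X v e x x'} → IsWStar i X v e x → IsWStar i X v e x' → x ≤ x'
  isWStar-≤ (inj₁ refl , _) (_ , 0≤x' , _)   = 0≤x'
  isWStar-≤ (inj₂ span , _) (_ , _ , maximal) = maximal _ span

  isWStar-unique : ∀ {i X v e x x'} → IsWStar i X v e x → IsWStar i X v e x' → x ≡ x'
  isWStar-unique {i} {X} {v} {e} w₁ w₂ =
    ≤-antisym (isWStar-≤ {i} {X} {v} {e} w₁ w₂) (isWStar-≤ {i} {X} {v} {e} w₂ w₁)

  -- Since θ ↦ above X v θ is antitone, maximality of x only has to be checked on the
  -- finitely many subsets of strictlyAbove X v x.
  WStarCertificate : Fin k → Subset n → (Fin n → ℚ) → Fin n → ℚ → Set
  WStarCertificate i X v e x =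
      (x ≡ 0ℚ ⊎ InSpan (M i) e (above X v x)) × 0ℚ ≤ x
    × (∀ Y → Y ⊆ strictlyAbove X v x → ¬ InSpan (M i) e Y)

  wStarCertificate⇒isWStar : ∀ {i X v e x} → WStarCertificate i X v e x → IsWStar i X v e x
  wStarCertificate⇒isWStar {X = X} {v} {x = x} (attained , 0≤x , unspanned) = attained , 0≤x , maximal
    where
    maximal : ∀ θ → _ → θ ≤ x
    maximal θ span with θ ≤? x
    ... | yes θ≤x = θ≤x
    ... | no  θ≰x = ⊥-elim (unspanned _ (above-⊆-strictlyAbove {X} {v} (≰⇒> θ≰x)) span)

  grow : State k n → Fin n → (Fin k → ℚ) → State k n
  grow s e x = st (S s ∪ ⁅ e ⁆) (g s [ e ]≔' (w e - Σℚ k x))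
                  (λ i → ws s i [ e ]≔' ((w e - Σℚ k x) + x i))

  growAlong : (Fin n → Fin k → ℚ) → State k n → List (Fin n) → State k n
  growAlong x s []       = s
  growAlong x s (e ∷ es) = growAlong x (grow s e (x e)) es

  record KeepsAll (s : State k n) (e : Fin n) (x : Fin k → ℚ) : Set where
    field
      wstar     : ∀ i → IsWStar i (S s) (ws s i) e (x i)
      accepted  : α * Σℚ k x < w e
      maxIndep  : ∀ i → ∃ (IsMaxWeightIndep i (S (grow s e x)) (ws (grow s e x) i))
      maxGain   : ∃ (IsMaxOn (S (grow s e x)) (g (grow s e x)))
      noRemoval : ∀ f f' → f ∈ S (grow s e x) → f' ∈ S (grow s e x) →
                  g (grow s e x) f' ≤ y * g (grow s e x) f
  open KeepsAll

  keepsAll⇒step : ∀ {s e x} → KeepsAll s e x → Step s e (grow s e x)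
  keepsAll⇒step K with maxGain K
  ... | gmax , gmaxIsMax@((f₀ , f₀∈ , refl) , _) =
    accept _ (proj₁ ∘ maxIndep K) gmax _ (wstar K) (accepted K) (proj₂ ∘ maxIndep K) gmaxIsMax
      λ f → (λ f∈ → f∈ , inj₁ (noRemoval K f f₀ f∈ f₀∈)) , proj₁

  wstar-agrees : ∀ {s c e x x'} → s ≈ˢ c → KeepsAll c e x →
                 (∀ i → IsWStar i (S s) (ws s i) e (x' i)) → x' ≗ x
  wstar-agrees {s} {c} {e} {x} s≈c K wstar' i =
    isWStar-unique {i} {S s} {ws s i} {e} (wstar' i)
      (isWStar-cong {i} {S s} {ws c i} {ws s i} (sym ∘ sameWs s≈c i)
        (subst (λ X → IsWStar i X (ws c i) e (x i)) (sym (sameS s≈c)) (wstar K i)))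

  step-unique : ∀ {s c e x s'} → KeepsAll c e x → s ≈ˢ c → Step s e s' → s' ≈ˢ grow c e x
  step-unique {e = e} K s≈c (reject x' wstar' rejected) =
    ⊥-elim (rejected (subst (λ t → α * t < w e) (sym (sumℚ-cong (allFin k) (wstar-agrees s≈c K wstar')))
                            (accepted K)))
  step-unique {s} {c} {e} {x} K s≈c (accept x' _ _ S' wstar' _ _ ((f₀ , f₀∈ , refl) , _) kept) = record
    { sameS  = trans (⊆-antisym (λ {f} f∈ → proj₁ (proj₁ (kept f) f∈))
                                (λ {f} f∈ → proj₂ (kept f) (f∈ , inj₁ (survives f∈))))
                     S₁≡
    ; sameG  = gain≗
    ; sameWs = λ i → ≔'-cong e (sameWs s≈c i) (cong₂ _+_ gain≡ (x'≗x i))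
    }
    where
    x'≗x = wstar-agrees s≈c K wstar'
    gain≡ : w e - Σℚ k x' ≡ w e - Σℚ k x
    gain≡ = cong (w e -_) (sumℚ-cong (allFin k) x'≗x)
    gain≗ : (g s [ e ]≔' (w e - Σℚ k x')) ≗ g (grow c e x)
    gain≗ = ≔'-cong e (sameG s≈c) gain≡
    S₁≡ : S s ∪ ⁅ e ⁆ ≡ S c ∪ ⁅ e ⁆
    S₁≡ = cong (_∪ ⁅ e ⁆) (sameS s≈c)
    survives : ∀ {f} → f ∈ S s ∪ ⁅ e ⁆ →
               (g s [ e ]≔' (w e - Σℚ k x')) f₀ ≤ y * (g s [ e ]≔' (w e - Σℚ k x')) f
    survives {f} f∈ = subst₂ (λ a b → a ≤ y * b) (sym (gain≗ f₀)) (sym (gain≗ f))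
      (noRemoval K f f₀ (subst (f ∈_) S₁≡ f∈) (subst (f₀ ∈_) S₁≡ f₀∈))

  data KeepsAllAlong (x : Fin n → Fin k → ℚ) : State k n → List (Fin n) → Set where
    []  : ∀ {s} → KeepsAllAlong x s []
    _∷_ : ∀ {s e es} → KeepsAll s e (x e) → KeepsAllAlong x (grow s e (x e)) es →
          KeepsAllAlong x s (e ∷ es)

  keepsAllAlong⇒run : ∀ {x s es} → KeepsAllAlong x s es → Run s es (growAlong x s es)
  keepsAllAlong⇒run []      = done
  keepsAllAlong⇒run (K ∷ R) = next (keepsAll⇒step K) (keepsAllAlong⇒run R)

  run-unique : ∀ {x c es s s'} → KeepsAllAlong x c es → s ≈ˢ c → Run s es s' → s' ≈ˢ growAlong x c es
  run-unique []      s≈c done            = s≈c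
  run-unique (K ∷ R) s≈c (next step run) = run-unique R (step-unique K s≈c step) run

module Decisions {k n : ℕ} (M : Fin k → Matroid n) (indep? : ∀ i → Decidable (Indep (M i))) where

  private
    inSpan? : ∀ i e X → Dec (InSpan (M i) e X)
    inSpan? i = DecidableMatroid.inSpan? (M i) (indep? i)

  inD? : ∀ i v X T e → Dec (InD (M i) v X T e)
  inD? i v X T e = e ∈? X ×-dec (e ∈? T ⊎-dec anySubset? λ C →
    C ⊆? T ×-dec inSpan? i e C ×-dec all? λ c → c ∈? C →-dec ≺? v c e)

  independentCover? : ∀ s T → Dec (IndependentCover M s T)
  independentCover? s T = T ⊆? S s ×-dec all? (λ i → indep? i T) ×-dec
    all? λ e → e ∈? S s →-dec any? λ i → inD? i (ws s i) (S s) T e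

  module Certificates (w : Fin n → ℚ) (α y : ℚ) where
    open Steps M w α y

    wStarCertificate? : ∀ i X v e x → Dec (WStarCertificate i X v e x)
    wStarCertificate? i X v e x =
      (x ℚ.≟ 0ℚ ⊎-dec inSpan? i e (above X v x)) ×-dec 0ℚ ≤? x ×-dec
      allSubset? λ Y → Y ⊆? strictlyAbove X v x →-dec ¬? (inSpan? i e Y)

    maxWeightIndep? : ∀ i X v → Dec (∃ (IsMaxWeightIndep i X v))
    maxWeightIndep? i X v = anySubset? λ T → T ⊆? X ×-dec indep? i T ×-dec
      allSubset? λ T' → T' ⊆? X →-dec indep? i T' →-dec weight v T' ≤? weight v T

    Argmax : Subset n → (Fin n → ℚ) → Set
    Argmax X v = ∃ λ f₀ → f₀ ∈ X × ∀ f → f ∈ X → v f ≤ v f₀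

    argmax? : ∀ X v → Dec (Argmax X v)
    argmax? X v = any? λ f₀ → f₀ ∈? X ×-dec all? λ f → f ∈? X →-dec v f ≤? v f₀

    argmax⇒isMaxOn : ∀ {X v} → Argmax X v → ∃ (IsMaxOn X v)
    argmax⇒isMaxOn {v = v} (f₀ , f₀∈ , max) = v f₀ , (f₀ , f₀∈ , refl) , max

    -- A finite, α- and y-free witness that the step accepts e and removes nothing, valid for
    -- all α ≤ α₀ and y ≥ y₀.
    Certificate : ℚ → ℚ → State k n → Fin n → (Fin k → ℚ) → Set
    Certificate α₀ y₀ s e x =
        (∀ i → WStarCertificate i (S s) (ws s i) e (x i))
      × α₀ * Σℚ k x < w e
      × (∀ i → ∃ (IsMaxWeightIndep i (S s') (ws s' i)))
      × Argmax (S s') (g s')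
      × (∀ f → f ∈ S s' → 1ℚ ≤ g s' f × g s' f ≤ y₀)
      where s' = grow s e x

    certificate? : ∀ α₀ y₀ s e x → Dec (Certificate α₀ y₀ s e x)
    certificate? α₀ y₀ s e x =
      all? (λ i → wStarCertificate? i (S s) (ws s i) e (x i)) ×-dec α₀ * Σℚ k x <? w e ×-dec
      all? (λ i → maxWeightIndep? i (S s') (ws s' i)) ×-dec argmax? (S s') (g s') ×-dec
      all? λ f → f ∈? S s' →-dec 1ℚ ≤? g s' f ×-dec g s' f ≤? y₀
      where s' = grow s e x

    certificate⇒keepsAll : ∀ {α₀ y₀ s e x} → α ≤ α₀ → y₀ ≤ y → Certificate α₀ y₀ s e x → KeepsAll s e x
    certificate⇒keepsAll {s = s} α≤α₀ y₀≤y (wstars , strictlyAccepted , maxIndep , argmax , gainBounds) = record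
      { wstar     = λ i → wStarCertificate⇒isWStar {i} {S s} {ws s i} (wstars i)
      ; accepted  = p≤q∧q*r<s⇒p*r<s α≤α₀ (sumℚ-nonNeg (allFin k) (proj₁ ∘ proj₂ ∘ wstars)) strictlyAccepted
      ; maxIndep  = maxIndep
      ; maxGain   = argmax⇒isMaxOn argmax
      ; noRemoval = λ f f' f∈ f'∈ →
          let 1≤gf , _ = gainBounds f f∈ ; 1≤gf' , gf'≤y₀ = gainBounds f' f'∈
          in  1≤a∧1≤b≤y⇒b≤y*a 1≤gf 1≤gf' (≤-trans gf'≤y₀ y₀≤y)
      }

circuit : Fin 3 → Subset 4
circuit = lookup ( (outside ∷ inside  ∷ inside  ∷ outside ∷ [])
                 ∷ (inside  ∷ outside ∷ inside  ∷ inside  ∷ [])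
                 ∷ (inside  ∷ inside  ∷ outside ∷ outside ∷ [])
                 ∷ [])

M : Fin 3 → Matroid 4
M i = SingleCircuit.singleCircuitMatroid (circuit i) (from-yes (all? (SingleCircuit.axioms? ∘ circuit)) i)

w : Fin 4 → ℚ
w = lookup (+ 4 / 1 ∷ + 6 / 1 ∷ + 3 / 1 ∷ + 4 / 1 ∷ [])

wstars : Fin 4 → Fin 3 → ℚ
wstars = lookup ∘ lookup ( (0ℚ      ∷ 0ℚ ∷ 0ℚ      ∷ [])
                         ∷ (0ℚ      ∷ 0ℚ ∷ + 4 / 1 ∷ [])
                         ∷ (+ 2 / 1 ∷ 0ℚ ∷ 0ℚ      ∷ [])
                         ∷ (0ℚ      ∷ 1ℚ ∷ 0ℚ      ∷ [])
                         ∷ [])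

α₀ y₀ : ℚ
α₀ = + 5 / 4
y₀ = + 4 / 1

open Decisions M (λ i → SingleCircuit.avoids? (circuit i))

module Trace (α y : ℚ) (α≤α₀ : α ≤ α₀) (y₀≤y : y₀ ≤ y) where
  open Steps M w α y
  open Certificates w α y

  certified : ∀ {s e} {ok : True (certificate? α₀ y₀ s e (wstars e))} → KeepsAll s e (wstars e)
  certified {ok = ok} = certificate⇒keepsAll α≤α₀ y₀≤y (toWitness ok)

  final : State 3 4
  final = growAlong wstars initState (allFin 4)

  trace : KeepsAllAlong wstars initState (allFin 4)
  trace = certified ∷ certified ∷ certified ∷ certified ∷ []

  allKept : ∀ e → e ∈ S final
  allKept = from-yes (all? (_∈? S final))

  noIndependentCover : ¬ ∃ (IndependentCover M final)
  noIndependentCover = from-no (anySubset? (independentCover? final))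

proposition6p1 :
    ∃ λ (n : ℕ) → Σ (Fin n → ℚ) λ w → (∀ e → 0ℚ ≤ w e) × Σ (Fin 3 → Matroid n) λ M →
      Σ ℚ λ α₀ → 1ℚ < α₀ × Σ ℚ λ y₀ →
        ∀ (α y : ℚ) → 1ℚ < α → α < α₀ → y₀ ≤ y →
          (∃ λ s → AlgorithmK.FinalState M w α y s)
          × (∀ s → AlgorithmK.FinalState M w α y s →
               (∀ e → e ∈ S s)
               × ¬ (∃ λ (T : Subset n) → T ⊆ S s × (∀ i → Indep (M i) T)
                      × (∀ e → e ∈ S s → ∃ λ i → InD (M i) (ws s i) (S s) T e)))
proposition6p1 =
  4 , w , from-yes (all? λ e → 0ℚ ≤? w e) , M , α₀ , from-yes (1ℚ <? α₀) , y₀ ,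
  λ α y _ α<α₀ y₀≤y →
    let open Trace α y (<⇒≤ α<α₀) y₀≤y
        open Steps M w α y
    in  (final , keepsAllAlong⇒run trace) ,
        λ s run → let s≈final = run-unique trace ≈ˢ-refl run in
          (λ e → subst (e ∈_) (sym (sameS s≈final)) (allKept e)) ,
          noIndependentCover ∘ Product.map₂ (independentCover-cong {M = M} s≈final)
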